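{- Let $\Pi.\phi$ be a QBF over universal variables $U$ and existential variables $E$. Consider an execution of the algorithm below on $\Pi.\phi$, and let $A_{i-1}\subseteq A_i$ (sets of full assignments of $U$) and $S_i$ (set of full assignments of $E$) be the sets obtained in iteration $i$. (1) If $\bigwedge_{\alpha\in A_{i-1}}\phi^\alpha$ is satisfiable, then $S_i$ completes $A_{i-1}$, i.e. for every $\mu\in A_{i-1}$ there is $\nu\in S_i$ such that $\mu\nu(\phi)$ is true. (2) If $\bigwedge_{\sigma\in S_i}\lnot\phi^\sigma$ is satisfiable, then $A_i$ completes $S_i$, i.e. for every $\nu\in S_i$ there is $\mu\in A_i$ such that $\nu\mu(\lnot\phi)$ is true. Algorithm: set $A_0:=\{\alpha_0\}$ for an arbitrary full assignment $\alpha_0\colon U\to\{\top,\bot\}$, $S_0:=\emptyset$, $i:=1$. Repeat: (a) check satisfiability of $\bigwedge_{\alpha\in A_{i-1}}\phi^\alpha$; if unsatisfiable return false, otherwise let $\tau$ be a satisfying assignment (assigning all $x^\alpha$, $x\in E$, $\alpha\in A_{i-1}$) and set $S_i:=S_{i-1}\cup\{(\tau|_{E^\alpha})^{ -\alpha}\mid \alpha\in A_{i-1}\}$; (b) check satisfiability of $\bigwedge_{\sigma\in S_i}\lnot\phi^\sigma$; if unsatisfiable return true, otherwise let $\rho$ be a satisfying assignment (assigning all $x^\sigma$, $x\in U$, $\sigma\in S_i$) and set $A_i:=A_{i-1}\cup\{(\rho|_{U^\sigma})^{ -\sigma}\mid\sigma\in S_i\}$; (c) increment $i$.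
   Context: A QBF is $\Pi.\phi$ where $\Pi=Q_1x_1\ldots Q_nx_n$ with $Q_i\in\{\forall,\exists\}$ and pairwise distinct variables, $X=\{x_1,\dots,x_n\}$, $\phi$ a propositional formula over $X$; $U$ ($E$) is the set of universally (existentially) quantified variables, and $x_i<_\Pi x_j$ iff $i<j$. An assignment for $Y$ is $\sigma\colon Y\to\{\top,\bot,\epsilon\}$ ($\epsilon$ = unassigned), full if it never takes value $\epsilon$; $\sigma|_Z$ is its restriction to $Z$. For full assignments $\mu$ of $U$ and $\nu$ of $E$, $\mu\nu$ is the combined assignment of $X$ and $\mu\nu(\phi)$ the resulting truth value. Instantiation: for an assignment $\sigma$ on a subset of $X$ (extended by $\epsilon$), $\phi^\sigma$ is obtained from $\phi$ by replacing every $x$ with $\sigma(x)\neq\epsilon$ by $\sigma(x)$ (with propositional simplification), and every $x$ with $\sigma(x)=\epsilon$ by the annotated variable $x^\omega$, where $\omega=\sigma(x_{k_1})\cdots\sigma(x_{k_m})$ for $x_{k_1}<_\Pi\cdots<_\Pi x_{k_m}$ all variables preceding $x$, each $\epsilon$ contributing the empty word (empty annotation identifies $x^\omega$ with $x$). Annotated variables with the same name and annotation are the same variable. Write $x^\sigma$ for the variable replacing $x$ in $\phi^\sigma$, $E^\sigma=\{x^\sigma: x\in E,\sigma(x)=\epsilon\}$, $U^\sigma=\{x^\sigma:x\in U,\sigma(x)=\epsilon\}$. For an assignment $\tau$ to annotated variables, $\tau^{ -\sigma}$ is the assignment $x\mapsto\tau(x^\sigma)$. For $A$ a set of full assignments of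 $U$ and $S$ a set of full assignments of $E$: $S$ completes $A$ if for every $\alpha\in A$ there is $\sigma\in S$ with $\alpha\sigma(\phi)$ true; $A$ completes $S$ if for every $\sigma\in S$ there is $\alpha\in A$ with $\alpha\sigma(\lnot\phi)$ true. -}

module Defs where

open import Data.Nat using (ℕ; suc)
open import Data.Bool using (Bool; true; false; not; _∧_; _∨_)
open import Data.Fin using (Fin; _<?_)
open import Data.Maybe using (Maybe; just; nothing; maybe)
open import Data.List using (List; []; _∷_; _++_; map; foldr; mapMaybe; filter; allFin)
open import Data.List.Relation.Unary.All using (All)
open import Data.List.Relation.Unary.Any using (Any)
open import Data.Product using (_×_; _,_)
open import Relation.Binary.PropositionalEquality using (_≡_; refl)

data Quant : Set where
  ∀q ∃q : Quant

data Form (V : Set) : Set where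
  var  : V → Form V
  ⊤f   : Form V
  ⊥f   : Form V
  ¬f_  : Form V → Form V
  _∧f_ : Form V → Form V → Form V
  _∨f_ : Form V → Form V → Form V

eval : {V : Set} → (V → Bool) → Form V → Bool
eval τ (var x)  = τ x
eval τ ⊤f       = true
eval τ ⊥f       = false
eval τ (¬f f)   = not (eval τ f)
eval τ (f ∧f g) = eval τ f ∧ eval τ g
eval τ (f ∨f g) = eval τ f ∨ eval τ g

const : {V : Set} → Bool → Form V
const true  = ⊤f
const false = ⊥f

⋀ : {V : Set} → List (Form V) → Form V
⋀ = foldr _∧f_ ⊤f

pick : {A : Set} (c : Quant) → (c ≡ ∀q → A) → (c ≡ ∃q → A) → A
pick ∀q f g = f refl
pick ∃q f g = g refl

-- A QBF Π.φ with variables x₀ < x₁ < … < x_{n-1} (prefix order = index order),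
-- quantifier prefix q, and matrix φ.
module QBF {n : ℕ} (q : Fin n → Quant) (φ : Form (Fin n)) where

  UAss : Set
  UAss = (x : Fin n) → q x ≡ ∀q → Bool

  EAss : Set
  EAss = (x : Fin n) → q x ≡ ∃q → Bool

  combine : UAss → EAss → Fin n → Bool
  combine μ ν x = pick (q x) (μ x) (ν x)

  -- partial assignments: nothing = ε (unassigned)
  PAss : Set
  PAss = Fin n → Maybe Bool

  uPart : UAss → PAss
  uPart μ x = pick (q x) (λ p → just (μ x p)) (λ _ → nothing)

  ePart : EAss → PAss
  ePart ν x = pick (q x) (λ _ → nothing) (λ p → just (ν x p))

  -- annotated variables x^ω
  AVar : Set
  AVar = Fin n × List Bool

  preceding : Fin n → List (Fin n)
  preceding x = filter (_<? x) (allFin n)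

  -- annotation ω: values of σ on preceding variables, ε contributing the empty word
  annot : PAss → Fin n → List Bool
  annot σ x = mapMaybe σ (preceding x)

  avar : PAss → Fin n → AVar
  avar σ x = (x , annot σ x)

  -- instantiation φ^σ (without propositional simplification; semantically identical)
  inst : PAss → Form (Fin n) → Form AVar
  inst σ (var x)  = maybe const (var (avar σ x)) (σ x)
  inst σ ⊤f       = ⊤f
  inst σ ⊥f       = ⊥f
  inst σ (¬f f)   = ¬f inst σ f
  inst σ (f ∧f g) = inst σ f ∧f inst σ g
  inst σ (f ∨f g) = inst σ f ∨f inst σ g

  conjU : List UAss → Form AVar
  conjU A = ⋀ (map (λ α → inst (uPart α) φ) A)

  conjE : List EAss → Form AVar
  conjE S = ⋀ (map (λ σ → ¬f inst (ePart σ) φ) S)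

  restrE : (AVar → Bool) → UAss → EAss
  restrE τ α x _ = τ (avar (uPart α) x)

  restrU : (AVar → Bool) → EAss → UAss
  restrU ρ σ x _ = ρ (avar (ePart σ) x)

  SCompletes : List EAss → List UAss → Set
  SCompletes S A = All (λ α → Any (λ σ → eval (combine α σ) φ ≡ true) S) A

  ACompletes : List UAss → List EAss → Set
  ACompletes A S = All (λ σ → Any (λ α → eval (combine α σ) (¬f φ) ≡ true) A) S

  -- Reach i A S : some execution of the algorithm reaches the start of iteration i
  -- with A = A_{i-1} and S = S_{i-1}.
  data Reach : ℕ → List UAss → List EAss → Set where
    start : (α₀ : UAss) → Reach 1 (α₀ ∷ []) []
    step  : ∀ {i A S} → Reach i A S →
            (τ : AVar → Bool) → eval τ (conjU A) ≡ true →
            (ρ : AVar → Bool) → eval ρ (conjE (S ++ map (restrE τ) A)) ≡ true →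
            Reach (suc i) (A ++ map (restrU ρ) (S ++ map (restrE τ) A))
                          (S ++ map (restrE τ) A)

-- Evaluating the instantiation φ^σ under an assignment τ of annotated variables is the same as
-- evaluating φ under σ with every unassigned x read off τ at x^σ. For σ = α ∈ A this filled
-- assignment is exactly α combined with (τ|_{E^α})^{-α}, so a model τ of ⋀_{α∈A} φ^α yields, for
-- each α, the completion (τ|_{E^α})^{-α} that step (a) adds to S. Dually a model ρ of
-- ⋀_{σ∈S} ¬φ^σ yields, for each σ, the countermove (ρ|_{U^σ})^{-σ} that step (b) adds to A.
-- Neither half depends on the history of the run.
module Submission where

open import Defs
open import Data.Nat using (ℕ)
open import Data.Bool using (Bool; true; false; not; _∧_; _∨_)
open import Data.Fin using (Fin)
open import Data.List using (List; []; _∷_; _++_; map)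
open import Data.Maybe using (just; nothing; fromMaybe)
open import Data.Product using (_×_; _,_)
open import Data.List.Relation.Unary.All as All using (All; []; _∷_)
open import Data.List.Relation.Unary.All.Properties using (map⁻)
open import Data.List.Relation.Unary.Any using (Any; here; there)
open import Data.List.Relation.Unary.Any.Properties using (++⁺ʳ)
open import Relation.Binary.PropositionalEquality using (_≡_; refl; cong; cong₂; trans; sym)

module _ {V : Set} where

  eval-const : (τ : V → Bool) (b : Bool) → eval τ (const b) ≡ b
  eval-const τ true  = refl
  eval-const τ false = refl

  eval-cong : {τ τ′ : V → Bool} → (∀ v → τ v ≡ τ′ v) → (f : Form V) → eval τ f ≡ eval τ′ f
  eval-cong τ≗τ′ (var v)  = τ≗τ′ v
  eval-cong τ≗τ′ ⊤f       = refl
  eval-cong τ≗τ′ ⊥f       = refl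
  eval-cong τ≗τ′ (¬f f)   = cong not (eval-cong τ≗τ′ f)
  eval-cong τ≗τ′ (f ∧f g) = cong₂ _∧_ (eval-cong τ≗τ′ f) (eval-cong τ≗τ′ g)
  eval-cong τ≗τ′ (f ∨f g) = cong₂ _∨_ (eval-cong τ≗τ′ f) (eval-cong τ≗τ′ g)

  eval-⋀ : (τ : V → Bool) (fs : List (Form V)) → eval τ (⋀ fs) ≡ true → All (λ f → eval τ f ≡ true) fs
  eval-⋀ τ []       _ = []
  eval-⋀ τ (f ∷ fs) e with eval τ f in τ⊨f
  ... | true = τ⊨f ∷ eval-⋀ τ fs e

pick-natural : {A B : Set} (h : A → B) (c : Quant) (f : c ≡ ∀q → A) (g : c ≡ ∃q → A) →
               h (pick c f g) ≡ pick c (λ p → h (f p)) (λ p → h (g p))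
pick-natural h ∀q f g = refl
pick-natural h ∃q f g = refl

All-Any-map⁺ : {X Y : Set} {R : X → Y → Set} (g : X → Y) {xs : List X} →
               All (λ x → R x (g x)) xs → All (λ x → Any (R x) (map g xs)) xs
All-Any-map⁺ g []       = []
All-Any-map⁺ g (r ∷ rs) = here r ∷ All.map there (All-Any-map⁺ g rs)

module _ {n : ℕ} (q : Fin n → Quant) (φ : Form (Fin n)) where
  open QBF q φ

  filled : PAss → (AVar → Bool) → Fin n → Bool
  filled σ τ x = fromMaybe (τ (avar σ x)) (σ x)

  eval-inst : (σ : PAss) (τ : AVar → Bool) (f : Form (Fin n)) →
              eval τ (inst σ f) ≡ eval (filled σ τ) f
  eval-inst σ τ (var x) with σ x
  ... | just b  = eval-const τ b
  ... | nothing = refl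
  eval-inst σ τ ⊤f       = refl
  eval-inst σ τ ⊥f       = refl
  eval-inst σ τ (¬f f)   = cong not (eval-inst σ τ f)
  eval-inst σ τ (f ∧f g) = cong₂ _∧_ (eval-inst σ τ f) (eval-inst σ τ g)
  eval-inst σ τ (f ∨f g) = cong₂ _∨_ (eval-inst σ τ f) (eval-inst σ τ g)

  eval-inst-uPart : (τ : AVar → Bool) (α : UAss) (f : Form (Fin n)) →
                    eval τ (inst (uPart α) f) ≡ eval (combine α (restrE τ α)) f
  eval-inst-uPart τ α f = trans (eval-inst (uPart α) τ f) (eval-cong filled≗combine f)
    where
    filled≗combine : ∀ x → filled (uPart α) τ x ≡ combine α (restrE τ α) x
    filled≗combine x = pick-natural (fromMaybe (τ (avar (uPart α) x))) (q x) _ _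

  eval-inst-ePart : (ρ : AVar → Bool) (σ : EAss) (f : Form (Fin n)) →
                    eval ρ (inst (ePart σ) f) ≡ eval (combine (restrU ρ σ) σ) f
  eval-inst-ePart ρ σ f = trans (eval-inst (ePart σ) ρ f) (eval-cong filled≗combine f)
    where
    filled≗combine : ∀ x → filled (ePart σ) ρ x ≡ combine (restrU ρ σ) σ x
    filled≗combine x = pick-natural (fromMaybe (ρ (avar (ePart σ) x))) (q x) _ _

  restrE-completes : (τ : AVar → Bool) (A : List UAss) → eval τ (conjU A) ≡ true →
                     SCompletes (map (restrE τ) A) A
  restrE-completes τ A τ⊨A = All-Any-map⁺ (restrE τ) (All.map models (map⁻ (eval-⋀ τ _ τ⊨A)))
    where
    models : ∀ {α} → eval τ (inst (uPart α) φ) ≡ true → eval (combine α (restrE τ α)) φ ≡ true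
    models {α} = trans (sym (eval-inst-uPart τ α φ))

  restrU-completes : (ρ : AVar → Bool) (S : List EAss) → eval ρ (conjE S) ≡ true →
                     ACompletes (map (restrU ρ) S) S
  restrU-completes ρ S ρ⊨S = All-Any-map⁺ (restrU ρ) (All.map models (map⁻ (eval-⋀ ρ _ ρ⊨S)))
    where
    models : ∀ {σ} → not (eval ρ (inst (ePart σ) φ)) ≡ true →
             not (eval (combine (restrU ρ σ) σ) φ) ≡ true
    models {σ} = trans (sym (cong not (eval-inst-ePart ρ σ φ)))

lemma5 : {n : ℕ} (q : Fin n → Quant) (φ : Form (Fin n)) →
         let open QBF q φ in
         (i : ℕ) (A : List UAss) (S : List EAss) → Reach i A S →
         ((τ : AVar → Bool) → eval τ (conjU A) ≡ true →
           SCompletes (S ++ map (restrE τ) A) A)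
         ×
         ((τ : AVar → Bool) → eval τ (conjU A) ≡ true →
           (ρ : AVar → Bool) → eval ρ (conjE (S ++ map (restrE τ) A)) ≡ true →
           ACompletes (A ++ map (restrU ρ) (S ++ map (restrE τ) A))
                      (S ++ map (restrE τ) A))
lemma5 q φ i A S _ =
  (λ τ τ⊨A → All.map (++⁺ʳ S) (restrE-completes q φ τ A τ⊨A)) ,
  (λ τ _ ρ ρ⊨S → All.map (++⁺ʳ A) (restrU-completes q φ ρ _ ρ⊨S))
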